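{- The complete bipartite graph $K_{2,3}$ is not $i$-graph realizable; that is, there is no graph $G$ with $\mathcal{I}(G)\cong K_{2,3}$.
   Context: All graphs are finite and simple. For a graph $G$, $i(G)$ denotes the minimum cardinality of an independent dominating set of $G$; an independent dominating set of cardinality $i(G)$ is an $i$-set of $G$. The $i$-graph $\mathcal{I}(G)$ of $G$ is the graph whose vertices are the $i$-sets of $G$, where two $i$-sets $S$ and $S'$ are adjacent if and only if there is an edge $xy\in E(G)$ with $S'=(S-\{x\})\cup\{y\}$. A graph $H$ is $i$-graph realizable if there exists a graph $G$ with $\mathcal{I}(G)\cong H$. -}

module Defs where

open import Data.Nat using (ℕ; _≤_; _<_)
open import Data.Bool using (Bool; true; false)
open import Data.Fin using (Fin; toℕ)
open import Data.Fin.Subset using (Subset; _∈_; _∉_; ∣_∣; ⁅_⁆; _∪_; _-_)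
open import Data.Product using (Σ; _×_; ∃; ∃-syntax)
open import Data.Sum using (_⊎_)
open import Relation.Binary.PropositionalEquality using (_≡_; _≢_)
open import Relation.Nullary using (¬_)

record Graph : Set where
  field
    n      : ℕ
    adj    : Fin n → Fin n → Bool
    sym    : ∀ x y → adj x y ≡ adj y x
    irrefl : ∀ x → adj x x ≡ false
open Graph public

module _ (G : Graph) where

  Independent : Subset (n G) → Set
  Independent S = ∀ x y → x ∈ S → y ∈ S → adj G x y ≡ false

  Dominating : Subset (n G) → Set
  Dominating S = ∀ v → v ∈ S ⊎ (∃[ u ] (u ∈ S × adj G u v ≡ true))

  IndepDom : Subset (n G) → Set
  IndepDom S = Independent S × Dominating S

  IsISet : Subset (n G) → Set
  IsISet S = IndepDom S × (∀ T → IndepDom T → ∣ S ∣ ≤ ∣ T ∣)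

  -- Adjacency in the i-graph: S' = (S - {x}) ∪ {y} for an edge xy of G,
  -- with S ≢ S' (the i-graph is a simple graph; no loops).
  IAdj : Subset (n G) → Subset (n G) → Set
  IAdj S S' = S ≢ S' × (∃[ x ] ∃[ y ] (adj G x y ≡ true × S' ≡ (S - x) ∪ ⁅ y ⁆))

record IGraphIso (G : Graph) (m : ℕ) (HAdj : Fin m → Fin m → Set) : Set where
  field
    φ          : Fin m → Subset (n G)
    φ-iset     : ∀ a → IsISet G (φ a)
    φ-injective : ∀ a b → φ a ≡ φ b → a ≡ b
    φ-surjective : ∀ S → IsISet G S → ∃[ a ] (φ a ≡ S)
    adj-to     : ∀ a b → HAdj a b → IAdj G (φ a) (φ b)
    adj-from   : ∀ a b → IAdj G (φ a) (φ b) → HAdj a b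

K23Adj : Fin 5 → Fin 5 → Set
K23Adj a b = (toℕ a < 2 × 2 ≤ toℕ b) ⊎ (2 ≤ toℕ a × toℕ b < 2)

{-# OPTIONS --safe #-}
-- All i-sets have the same size, so an edge S – T of the i-graph exchanges a
-- vertex u ∈ S for a neighbour w ∉ S. Let A, B be the two non-adjacent
-- vertices of one side of K_{2,3} and X = A - a + x a common neighbour. The
-- exchange from X to B cannot remove x again, since B would then be equal or
-- adjacent to A; hence x ∈ B \ A. But B is two exchanges away from A, so
-- B \ A has at most two elements, and two of the three common neighbours X, Y
-- enter the same x. Independence of Y then forces them to remove the same
-- vertex of A, so X = Y.

module Submission where

open import Defs
open import Function using (_∘_)
open import Relation.Nullary using (¬_; yes; no; contradiction)

open import Data.Bool using (true)
open import Data.Empty using (⊥)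
open import Data.Fin using (Fin; suc)
open import Data.Fin.Patterns using (0F; 1F; 2F; 3F; 4F)
open import Data.Fin.Properties using (_≟_)
open import Data.Fin.Subset
  using (Subset; inside; outside; _∈_; _∉_; _⊆_; _─_; _-_; _∪_; ⁅_⁆; ∣_∣)
open import Data.Fin.Subset.Properties
  using ( x∈⁅x⁆; x∈⁅y⁆⇒x≡y; x∈p∪q⁻; x∈p∪q⁺; p─q⊆p; x∈p∧x≢y⇒x∈p-y; x∈p⇒∣p-x∣<∣p∣
        ; ⊆-antisym; p⊆q⇒∣p∣≤∣q∣; p⊂q⇒∣p∣<∣q∣; _∈?_ )
open import Data.Nat using (ℕ; _≤_; z≤n; s≤s)
open import Data.Nat.Properties using (≤-antisym; <-irrefl; ≤-<-trans)
open import Data.Product using (Σ; _×_; _,_; proj₁; proj₂)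
open import Data.Sum using (_⊎_; inj₁; inj₂)
open import Data.Vec using (_∷_; here; there)
open import Relation.Binary.PropositionalEquality
  using (_≡_; _≢_; refl; trans; cong; cong₂; subst; module ≡-Reasoning)
  renaming (sym to ≡-sym)

x∈p─q⇒x∉q : ∀ {m} (p q : Subset m) {x} → x ∈ p ─ q → x ∉ q
x∈p─q⇒x∉q (inside ∷ p) (outside ∷ q) here ()
x∈p─q⇒x∉q (s ∷ p) (outside ∷ q) (there i) (there j) = x∈p─q⇒x∉q p q i j
x∈p─q⇒x∉q (s ∷ p) (inside ∷ q) (there i) (there j) = x∈p─q⇒x∉q p q i j

swap : ∀ {m} → Subset m → Fin m → Fin m → Subset m
swap S u w = (S - u) ∪ ⁅ w ⁆

module _ {m : ℕ} where

  ∈-swap⁻ : ∀ S u w {x : Fin m} → x ∈ swap S u w → (x ∈ S × x ≢ u) ⊎ x ≡ w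
  ∈-swap⁻ S u w x∈ with x∈p∪q⁻ (S - u) ⁅ w ⁆ x∈
  ... | inj₁ x∈S-u = inj₁ (p─q⊆p S ⁅ u ⁆ x∈S-u , λ { refl → x∈p─q⇒x∉q S ⁅ u ⁆ x∈S-u (x∈⁅x⁆ u) })
  ... | inj₂ x∈⁅w⁆ = inj₂ (x∈⁅y⁆⇒x≡y w x∈⁅w⁆)

  ∈-swap⁺ : ∀ S u w {x : Fin m} → x ∈ S → x ≢ u → x ∈ swap S u w
  ∈-swap⁺ S u w x∈S x≢u = x∈p∪q⁺ (inj₁ (x∈p∧x≢y⇒x∈p-y x∈S x≢u))

  entering∈swap : ∀ S u (w : Fin m) → w ∈ swap S u w
  entering∈swap S u w = x∈p∪q⁺ (inj₂ (x∈⁅x⁆ w))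

  swap-⊆ : ∀ S u w {T : Subset m} → S - u ⊆ T → w ∈ T → swap S u w ⊆ T
  swap-⊆ S u w S-u⊆T w∈T x∈ with x∈p∪q⁻ (S - u) ⁅ w ⁆ x∈
  ... | inj₁ x∈S-u = S-u⊆T x∈S-u
  ... | inj₂ x∈⁅w⁆ = subst (_∈ _) (≡-sym (x∈⁅y⁆⇒x≡y w x∈⁅w⁆)) w∈T

  ⊆-swap : ∀ S u w → u ∉ S → S ⊆ swap S u w
  ⊆-swap S u w u∉S {x} x∈S = ∈-swap⁺ S u w x∈S λ { refl → u∉S x∈S }

  swap-self : ∀ S (u : Fin m) → u ∈ S → swap S u u ≡ S
  swap-self S u u∈S = ⊆-antisym (swap-⊆ S u u (p─q⊆p S ⁅ u ⁆) u∈S) S⊆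
    where
    S⊆ : S ⊆ swap S u u
    S⊆ {x} x∈S with x ≟ u
    ... | yes refl = entering∈swap S u u
    ... | no x≢u   = ∈-swap⁺ S u u x∈S x≢u

  swap-swap : ∀ S u x (d : Fin m) → x ∉ S → swap (swap S u x) x d ≡ swap S u d
  swap-swap S u x d x∉S = ⊆-antisym ⊆-direct direct-⊆
    where
    ⊆-direct : swap (swap S u x) x d ⊆ swap S u d
    ⊆-direct {v} v∈ with ∈-swap⁻ (swap S u x) x d v∈
    ... | inj₂ refl = entering∈swap S u d
    ... | inj₁ (v∈′ , v≢x) with ∈-swap⁻ S u x v∈′
    ...   | inj₁ (v∈S , v≢u) = ∈-swap⁺ S u d v∈S v≢u
    ...   | inj₂ v≡x         = contradiction v≡x v≢x
    direct-⊆ : swap S u d ⊆ swap (swap S u x) x d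
    direct-⊆ {v} v∈ with ∈-swap⁻ S u d v∈
    ... | inj₂ refl = entering∈swap (swap S u x) x d
    ... | inj₁ (v∈S , v≢u) =
      ∈-swap⁺ (swap S u x) x d (∈-swap⁺ S u x v∈S v≢u) λ { refl → x∉S v∈S }

  ∈-swap²⁻ : ∀ S u x c d {v : Fin m} → v ∈ swap (swap S u x) c d → v ∉ S → v ≡ x ⊎ v ≡ d
  ∈-swap²⁻ S u x c d v∈ v∉S with ∈-swap⁻ (swap S u x) c d v∈
  ... | inj₂ v≡d = inj₂ v≡d
  ... | inj₁ (v∈′ , _) with ∈-swap⁻ S u x v∈′
  ...   | inj₁ (v∈S , _) = contradiction v∈S v∉S
  ...   | inj₂ v≡x       = inj₁ v≡x

  swap-exchanges : ∀ S u (w : Fin m) → u ≢ w → ∣ S ∣ ≡ ∣ swap S u w ∣ → S ≢ swap S u w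
                 → u ∈ S × w ∉ S
  swap-exchanges S u w u≢w ∣S∣≡ S≢ with u ∈? S | w ∈? S
  ... | yes u∈S | no w∉S = u∈S , w∉S
  ... | yes u∈S | yes w∈S =
    contradiction (≤-<-trans ∣swap∣≤∣S-u∣ (x∈p⇒∣p-x∣<∣p∣ u∈S)) (<-irrefl (≡-sym ∣S∣≡))
    where
    ∣swap∣≤∣S-u∣ : ∣ swap S u w ∣ ≤ ∣ S - u ∣
    ∣swap∣≤∣S-u∣ = p⊆q⇒∣p∣≤∣q∣ (swap-⊆ S u w (λ v∈ → v∈) (x∈p∧x≢y⇒x∈p-y w∈S λ { refl → u≢w refl }))
  ... | no u∉S | yes w∈S =
    contradiction (⊆-antisym (⊆-swap S u w u∉S) (swap-⊆ S u w (p─q⊆p S ⁅ u ⁆) w∈S)) S≢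
  ... | no u∉S | no w∉S =
    contradiction (p⊂q⇒∣p∣<∣q∣ (⊆-swap S u w u∉S , w , entering∈swap S u w , w∉S)) (<-irrefl ∣S∣≡)

module _ (G : Graph) where

  adj⇒≢ : ∀ {u w} → adj G u w ≡ true → u ≢ w
  adj⇒≢ {u} uw refl with trans (≡-sym uw) (irrefl G u)
  ... | ()

  iset-∣∣-≡ : ∀ {S T} → IsISet G S → IsISet G T → ∣ S ∣ ≡ ∣ T ∣
  iset-∣∣-≡ (S-id , S-min) (T-id , T-min) = ≤-antisym (S-min _ T-id) (T-min _ S-id)

  iset-independent : ∀ {S} → IsISet G S → Independent G S
  iset-independent = proj₁ ∘ proj₁

  iset-dominating : ∀ {S} → IsISet G S → Dominating G S
  iset-dominating = proj₂ ∘ proj₁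

  -- The removed vertex u must be dominated in the new set, and only w can do it.
  swap-adj : ∀ {S u w} → Independent G S → Dominating G (swap S u w) → u ∈ S → w ∉ S
           → adj G u w ≡ true
  swap-adj {S} {u} {w} S-ind T-dom u∈S w∉S with T-dom u
  ... | inj₁ u∈T with ∈-swap⁻ S u w u∈T
  ...   | inj₁ (_ , u≢u) = contradiction refl u≢u
  ...   | inj₂ refl      = contradiction u∈S w∉S
  swap-adj {S} {u} {w} S-ind T-dom u∈S w∉S | inj₂ (v , v∈T , vu) with ∈-swap⁻ S u w v∈T
  ... | inj₁ (v∈S , _) with trans (≡-sym vu) (S-ind v u v∈S u∈S)
  ...   | ()
  swap-adj {S} {u} {w} S-ind T-dom u∈S w∉S | inj₂ (v , v∈T , vu) | inj₂ refl = trans (sym G u v) vu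

  swap-IAdj : ∀ {S u w} → Independent G S → Dominating G (swap S u w) → u ∈ S → w ∉ S
            → IAdj G S (swap S u w)
  swap-IAdj {S} {u} {w} S-ind T-dom u∈S w∉S =
    (λ S≡T → u∉T (subst (u ∈_) S≡T u∈S)) , u , w , swap-adj S-ind T-dom u∈S w∉S , refl
    where
    u∉T : u ∉ swap S u w
    u∉T u∈T with ∈-swap⁻ S u w u∈T
    ... | inj₁ (_ , u≢u) = u≢u refl
    ... | inj₂ refl      = w∉S u∈S

  record Exchange (S T : Subset (n G)) : Set where
    field
      leaving entering : Fin (n G)
      edge             : adj G leaving entering ≡ true
      leaving∈S        : leaving ∈ S
      entering∉S       : entering ∉ S
      T≡swap           : T ≡ swap S leaving entering
  open Exchange

  IAdj⇒Exchange : ∀ {S T} → IsISet G S → IsISet G T → IAdj G S T → Exchange S T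
  IAdj⇒Exchange {S} S-iset T-iset (S≢T , u , w , uw , refl)
    with u∈S , w∉S ← swap-exchanges S u w (adj⇒≢ uw) (iset-∣∣-≡ S-iset T-iset) S≢T = record
    { leaving = u ; entering = w ; edge = uw ; leaving∈S = u∈S ; entering∉S = w∉S ; T≡swap = refl }

  leaving-unique : ∀ {S a a′ x} → Independent G (swap S a′ x) → a ∈ S → adj G a x ≡ true
                 → a ≡ a′
  leaving-unique {S} {a} {a′} {x} T-ind a∈S ax with a ≟ a′
  ... | yes a≡a′ = a≡a′
  ... | no a≢a′ with trans (≡-sym ax) (T-ind a x (∈-swap⁺ S a′ x a∈S a≢a′) (entering∈swap S a′ x))
  ...   | ()

  entering-injective : ∀ {S X Y} → Independent G Y → (e : Exchange S X) (f : Exchange S Y)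
                     → entering e ≡ entering f → X ≡ Y
  entering-injective {S} {X} {Y} Y-ind e f ee≡ef = begin
    X                               ≡⟨ T≡swap e ⟩
    swap S (leaving e) (entering e) ≡⟨ cong₂ (swap S) le≡lf ee≡ef ⟩
    swap S (leaving f) (entering f) ≡⟨ ≡-sym (T≡swap f) ⟩
    Y                               ∎
    where
    open ≡-Reasoning
    le≡lf : leaving e ≡ leaving f
    le≡lf = leaving-unique (subst (Independent G) (T≡swap f) Y-ind) (leaving∈S e)
                           (subst (λ x → adj G (leaving e) x ≡ true) ee≡ef (edge e))

  exchange-undone : ∀ {A X B} (e : Exchange A X) (f : Exchange X B) → leaving f ≡ entering e
                  → B ≡ swap A (leaving e) (entering f)
  exchange-undone {A} {X} {B} e f c≡x = begin
    B                               ≡⟨ T≡swap f ⟩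
    swap X (leaving f) (entering f) ≡⟨ cong₂ (λ Y c → swap Y c (entering f)) (T≡swap e) c≡x ⟩
    swap (swap A (leaving e) (entering e)) (entering e) (entering f)
                                    ≡⟨ swap-swap A _ _ _ (entering∉S e) ⟩
    swap A (leaving e) (entering f) ∎
    where open ≡-Reasoning

  -- Undoing the first exchange would leave B at most one exchange away from A.
  second-leaving≢first-entering : ∀ {A X B} → Independent G A → Dominating G B → A ≢ B
    → ¬ IAdj G A B → (e : Exchange A X) (f : Exchange X B) → leaving f ≢ entering e
  second-leaving≢first-entering {A} A-ind B-dom A≢B ¬A~B e f c≡x
    with B≡ ← exchange-undone e f c≡x
    with entering f ∈? A
  ... | no d∉A = ¬A~B (subst (IAdj G A) (≡-sym B≡)
                   (swap-IAdj A-ind (subst (Dominating G) B≡ B-dom) (leaving∈S e) d∉A))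
  ... | yes d∈A with entering f ≟ leaving e
  ...   | no d≢a    = entering∉S f (subst (_ ∈_) (≡-sym (T≡swap e)) (∈-swap⁺ A _ _ d∈A d≢a))
  ...   | yes refl  = A≢B (≡-sym (trans B≡ (swap-self A _ d∈A)))

  entering-persists : ∀ {A X B} → IsISet G A → IsISet G X → IsISet G B → A ≢ B → ¬ IAdj G A B
    → IAdj G A X → IAdj G X B → Σ (Exchange A X) λ e → entering e ∈ B
  entering-persists A-iset X-iset B-iset A≢B ¬A~B A~X X~B = e , x∈B
    where
    e = IAdj⇒Exchange A-iset X-iset A~X
    f = IAdj⇒Exchange X-iset B-iset X~B
    x∈X : entering e ∈ _
    x∈X = subst (entering e ∈_) (≡-sym (T≡swap e)) (entering∈swap _ _ _)
    x≢c : entering e ≢ leaving f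
    x≢c x≡c = second-leaving≢first-entering (iset-independent A-iset) (iset-dominating B-iset)
                                            A≢B ¬A~B e f (≡-sym x≡c)
    x∈B = subst (entering e ∈_) (≡-sym (T≡swap f)) (∈-swap⁺ _ _ _ x∈X x≢c)

  entering-two-steps : ∀ {A X B v} (e : Exchange A X) (f : Exchange X B) → v ∈ B → v ∉ A
                     → v ≡ entering e ⊎ v ≡ entering f
  entering-two-steps {A} {v = v} e f v∈B v∉A =
    ∈-swap²⁻ A _ _ _ _ (subst (v ∈_) (trans (T≡swap f) (cong (λ Y → swap Y _ _) (T≡swap e))) v∈B) v∉A

  Between : Subset (n G) → Subset (n G) → Subset (n G) → Set
  Between A B X = IsISet G X × IAdj G A X × IAdj G X B

  no-three-between : ∀ {A B X Y Z} → IsISet G A → IsISet G B → A ≢ B → ¬ IAdj G A B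
    → Between A B X → Between A B Y → Between A B Z → X ≢ Y → Y ≢ Z → X ≢ Z → ⊥
  no-three-between A-iset B-iset A≢B ¬A~B
                   (X-iset , A~X , X~B) (Y-iset , A~Y , Y~B) (Z-iset , A~Z , Z~B) X≢Y Y≢Z X≢Z
    with e , _    ← entering-persists A-iset X-iset B-iset A≢B ¬A~B A~X X~B
    with e′ , y∈B ← entering-persists A-iset Y-iset B-iset A≢B ¬A~B A~Y Y~B
    with e″ , z∈B ← entering-persists A-iset Z-iset B-iset A≢B ¬A~B A~Z Z~B
    with f ← IAdj⇒Exchange X-iset B-iset X~B
    with entering-two-steps e f y∈B (entering∉S e′) | entering-two-steps e f z∈B (entering∉S e″)
  ... | inj₁ y≡x | _        = X≢Y (≡-sym (entering-injective (iset-independent X-iset) e′ e y≡x))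
  ... | inj₂ _   | inj₁ z≡x = X≢Z (≡-sym (entering-injective (iset-independent X-iset) e″ e z≡x))
  ... | inj₂ y≡d | inj₂ z≡d =
    Y≢Z (entering-injective (iset-independent Z-iset) e′ e″ (trans y≡d (≡-sym z≡d)))

0≁1 : ¬ K23Adj 0F 1F
0≁1 (inj₁ (_ , s≤s ()))
0≁1 (inj₂ (() , _))

0∼middle : ∀ {k} → K23Adj 0F (suc (suc k))
0∼middle = inj₁ (s≤s z≤n , s≤s (s≤s z≤n))

middle∼1 : ∀ {k} → K23Adj (suc (suc k)) 1F
middle∼1 = inj₂ (s≤s (s≤s z≤n) , s≤s (s≤s z≤n))

proposition3p2 : (G : Graph) → ¬ IGraphIso G 5 K23Adj
proposition3p2 G I =
  no-three-between G (φ-iset 0F) (φ-iset 1F) (distinct (λ ())) (λ A~B → 0≁1 (adj-from 0F 1F A~B))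
    (between 2F 0∼middle middle∼1) (between 3F 0∼middle middle∼1)
    (between 4F 0∼middle middle∼1) (distinct (λ ())) (distinct (λ ())) (distinct (λ ()))
  where
  open IGraphIso I
  distinct : ∀ {j k} → j ≢ k → φ j ≢ φ k
  distinct j≢k φj≡φk = j≢k (φ-injective _ _ φj≡φk)
  between : ∀ k → K23Adj 0F k → K23Adj k 1F → Between G (φ 0F) (φ 1F) (φ k)
  between k 0∼k k∼1 = φ-iset k , adj-to 0F k 0∼k , adj-to k 1F k∼1
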